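{- Let $n$ be a positive integer and let $m$ be the largest odd divisor of $n$. Let $sc_o(n)$ (resp. $sc_e(n)$) denote the sum of the smallest parts of all partitions of $n$ into an odd (resp. even) number of distinct consecutive parts. Then \[sc_o(n) - sc_e(n) = \frac{1}{2}\Big(\sigma(n) + \#\{t \mid m : t < \sqrt{2n}\} - \#\{t \mid m : t > \sqrt{2n}\}\Big),\] where $\sigma(n)$ is the sum of the positive divisors of $n$ and $t$ ranges over positive divisors of $m$.
   Context: A partition of $n$ into distinct consecutive parts is a representation $n = c + (c+1) + \cdots + (c+\ell-1)$ with $c \ge 1$, $\ell \ge 1$ (so the one-part partition $n$ itself counts, with $\ell = 1$); its number of parts is $\ell$ and its smallest part is $c$. -}

module Defs where

open import Data.Nat using (ℕ; zero; suc; _+_; _*_; _%_; _<_; _>_; _<?_; _⊔_)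
open import Data.Nat.Properties using (_≟_)
open import Data.Nat.Divisibility using (_∣_; _∣?_)
open import Data.Nat.ListAction using (sum)
open import Data.List using (List; []; _∷_; filter; map; length; upTo; concatMap; foldr)
open import Data.Product using (_×_; _,_; proj₁)
open import Relation.Binary.PropositionalEquality using (_≡_)
open import Relation.Nullary using (Dec)

one-to : ℕ → List ℕ
one-to n = map suc (upTo n)

consecSum : ℕ → ℕ → ℕ
consecSum c zero = 0
consecSum c (suc ℓ) = c + consecSum (suc c) ℓ

Odd : ℕ → Set
Odd k = k % 2 ≡ 1

odd? : (k : ℕ) → Dec (Odd k)
odd? k = (k % 2) ≟ 1

Even : ℕ → Set
Even k = k % 2 ≡ 0

even? : (k : ℕ) → Dec (Even k)
even? k = (k % 2) ≟ 0

-- all partitions of n into distinct consecutive parts, as pairs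
-- (smallest part c ≥ 1, number of parts ℓ ≥ 1) with consecSum c ℓ = n.
-- Since every part is ≥ 1, necessarily c ≤ n and ℓ ≤ n, so enumerating
-- c, ℓ ∈ {1,…,n} is exhaustive.
consecPartitions : ℕ → List (ℕ × ℕ)
consecPartitions n =
  filter (λ p → consecSum (proj₁ p) (Data.Product.proj₂ p) ≟ n)
    (concatMap (λ c → map (λ ℓ → (c , ℓ)) (one-to n)) (one-to n))

sco : ℕ → ℕ
sco n = sum (map proj₁ (filter (λ p → odd? (Data.Product.proj₂ p)) (consecPartitions n)))

sce : ℕ → ℕ
sce n = sum (map proj₁ (filter (λ p → even? (Data.Product.proj₂ p)) (consecPartitions n)))

divisors : ℕ → List ℕ
divisors n = filter (_∣? n) (one-to n)

σ : ℕ → ℕ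
σ n = sum (divisors n)

largestOddDivisor : ℕ → ℕ
largestOddDivisor n = foldr _⊔_ 0 (filter odd? (divisors n))

-- #{t ∣ m : t < √(2n)}; for t ∈ ℕ, t < √(2n) ⟺ t * t < 2 * n
#divBelow : ℕ → ℕ → ℕ
#divBelow m n = length (filter (λ t → (t * t) <? (2 * n)) (divisors m))

-- #{t ∣ m : t > √(2n)}; for t ∈ ℕ, t > √(2n) ⟺ t * t > 2 * n
#divAbove : ℕ → ℕ → ℕ
#divAbove m n = length (filter (λ t → (2 * n) <? (t * t)) (divisors m))

module Submission where

-- A partition of n into ℓ consecutive parts with smallest part c is a factorisation
-- 2n = ℓ (2c + ℓ - 1) into factors of opposite parity, ℓ being the smaller one. These
-- factorisations are {t , 2n/t} for the divisors t of m: if t² < 2n the partition has t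
-- (odd) parts and 2c = 2n/t - t + 1, if t² > 2n it has 2n/t (even) parts and
-- 2c = t - 2n/t + 1. Summing, 2 (sc_o - sc_e) = Σ_{t ∣ m} (2n/t - t) + #below - #above, and
-- Σ_{t ∣ m} 2n/t - Σ_{t ∣ m} t = σ(n) because the divisors of 2n add up both to
-- σ(n) + Σ_{t ∣ m} 2n/t (split by dividing n or not) and to Σ_{t ∣ m} t + 2σ(n) (split by parity).

open import Data.Nat using (ℕ; NonZero)

module FiniteSums where

  open import Data.Nat using (zero; suc; _+_; _*_; _≤_; _<_; z≤n; s≤s)
  open import Data.Nat.Properties
    using (_≟_; *-distribˡ-+; *-zeroʳ; +-commutativeSemigroup; +-identityʳ; <⇒≱; m≤n⇒m≤1+n;
           ≤-pred; ≤-refl; ≤-trans; ≤∧≢⇒<)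
  open import Data.Nat.ListAction using (sum)
  open import Data.Nat.ListAction.Properties using (sum-++)
  open import Data.List using (List; []; _∷_; [_]; _++_; map; filter; concatMap; length; upTo)
  open import Data.List.Properties using (map-++; upTo-∷ʳ)
  open import Data.Product using (∃; _×_; _,_; proj₁; proj₂)
  open import Data.Empty using (⊥-elim)
  open import Relation.Nullary using (Dec; yes; no; ¬_)
  open import Relation.Unary using (Pred; Decidable)
  open import Relation.Binary.PropositionalEquality hiding ([_])
  open import Function using (id; _∘_)
  open import Algebra.Properties.CommutativeSemigroup +-commutativeSemigroup using (interchange)
  open import Defs using (one-to)

  infixl 5 _when_

  _when_ : ∀ {a} {A : Set a} → ℕ → Dec A → ℕ
  x when yes _ = x
  x when no _  = 0

  when-yes : ∀ {a} {A : Set a} (d : Dec A) {x} → A → (x when d) ≡ x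
  when-yes (yes _) _ = refl
  when-yes (no ¬a) a = ⊥-elim (¬a a)

  when-no : ∀ {a} {A : Set a} (d : Dec A) {x} → ¬ A → (x when d) ≡ 0
  when-no (yes a) ¬a = ⊥-elim (¬a a)
  when-no (no _)  _  = refl

  0-when : ∀ {a} {A : Set a} (d : Dec A) → (0 when d) ≡ 0
  0-when (yes _) = refl
  0-when (no _)  = refl

  when-comm : ∀ {a b} {A : Set a} {B : Set b} (d : Dec A) (e : Dec B) x →
              (x when d when e) ≡ (x when e when d)
  when-comm (yes _) (yes _) x = refl
  when-comm (yes _) (no _)  x = refl
  when-comm (no _)  (yes _) x = refl
  when-comm (no _)  (no _)  x = refl

  ∑ : ℕ → (ℕ → ℕ) → ℕ
  ∑ zero    f = 0
  ∑ (suc N) f = ∑ N f + f (suc N)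

  InRange : ℕ → ℕ → Set
  InRange N i = 1 ≤ i × i ≤ N

  ∑-cong : ∀ N {f g} → (∀ i → InRange N i → f i ≡ g i) → ∑ N f ≡ ∑ N g
  ∑-cong zero    eq = refl
  ∑-cong (suc N) eq = cong₂ _+_ (∑-cong N (λ i (1≤i , i≤N) → eq i (1≤i , m≤n⇒m≤1+n i≤N)))
                                (eq (suc N) (s≤s z≤n , ≤-refl))

  ∑-vanishes : ∀ N {f} → (∀ i → InRange N i → f i ≡ 0) → ∑ N f ≡ 0
  ∑-vanishes zero    eq = refl
  ∑-vanishes (suc N) eq = cong₂ _+_ (∑-vanishes N (λ i (1≤i , i≤N) → eq i (1≤i , m≤n⇒m≤1+n i≤N)))
                                    (eq (suc N) (s≤s z≤n , ≤-refl))

  ∑-distrib-+ : ∀ N f g → ∑ N (λ i → f i + g i) ≡ ∑ N f + ∑ N g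
  ∑-distrib-+ zero    f g = refl
  ∑-distrib-+ (suc N) f g = trans (cong (_+ (f (suc N) + g (suc N))) (∑-distrib-+ N f g))
                                  (interchange (∑ N f) (∑ N g) (f (suc N)) (g (suc N)))

  *-distribˡ-∑ : ∀ k N f → k * ∑ N f ≡ ∑ N (λ i → k * f i)
  *-distribˡ-∑ k zero    f = *-zeroʳ k
  *-distribˡ-∑ k (suc N) f = trans (*-distribˡ-+ k (∑ N f) (f (suc N)))
                                   (cong (_+ k * f (suc N)) (*-distribˡ-∑ k N f))

  ∑-distrib-+₃ : ∀ N f g h → ∑ N (λ i → f i + g i + h i) ≡ ∑ N f + ∑ N g + ∑ N h
  ∑-distrib-+₃ N f g h = trans (∑-distrib-+ N _ h) (cong (_+ ∑ N h) (∑-distrib-+ N f g))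

  ∑-when : ∀ {a} {A : Set a} N f (d : Dec A) → ∑ N (λ i → f i when d) ≡ (∑ N f when d)
  ∑-when N f (yes _) = refl
  ∑-when N f (no _)  = ∑-vanishes N (λ _ _ → refl)

  ∑-comm : ∀ N M (F : ℕ → ℕ → ℕ) → ∑ N (λ i → ∑ M (F i)) ≡ ∑ M (λ j → ∑ N (λ i → F i j))
  ∑-comm zero    M F = sym (∑-vanishes M (λ _ _ → refl))
  ∑-comm (suc N) M F = trans (cong (_+ ∑ M (F (suc N))) (∑-comm N M F))
                             (sym (∑-distrib-+ M (λ j → ∑ N (λ i → F i j)) (F (suc N))))

  ∑≢0⇒∃ : ∀ N f → ¬ ∑ N f ≡ 0 → ∃ λ i → InRange N i × ¬ f i ≡ 0
  ∑≢0⇒∃ zero    f ∑≢0 = ⊥-elim (∑≢0 refl)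
  ∑≢0⇒∃ (suc N) f ∑≢0 with f (suc N) ≟ 0
  ... | no fN≢0 = suc N , (s≤s z≤n , ≤-refl) , fN≢0
  ... | yes fN≡0 with ∑≢0⇒∃ N f (λ ∑≡0 → ∑≢0 (cong₂ _+_ ∑≡0 fN≡0))
  ...   | i , (1≤i , i≤N) , fi≢0 = i , (1≤i , m≤n⇒m≤1+n i≤N) , fi≢0

  ∑-spike : ∀ M x k → (¬ x ≡ 0 → InRange M k) → ∑ M (λ j → x when (j ≟ k)) ≡ x
  ∑-spike M x k k∈M with x ≟ 0
  ... | yes refl = ∑-vanishes M (λ j _ → 0-when (j ≟ k))
  ... | no x≢0   = spike M (k∈M x≢0)
    where
    off : ∀ M → M < k → ∑ M (λ j → x when (j ≟ k)) ≡ 0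
    off M M<k = ∑-vanishes M (λ j (_ , j≤M) → when-no (j ≟ k) (λ { refl → <⇒≱ M<k j≤M }))
    spike : ∀ M → InRange M k → ∑ M (λ j → x when (j ≟ k)) ≡ x
    spike zero    (s≤s _ , ())
    spike (suc M) (1≤k , k≤1+M) with suc M ≟ k
    ... | yes refl = cong (_+ x) (off M ≤-refl)
    ... | no 1+M≢k = trans (+-identityʳ _) (spike M (1≤k , ≤-pred (≤∧≢⇒< k≤1+M (≢-sym 1+M≢k))))

  Matches : ∀ N M (f g φ ψ : ℕ → ℕ) → Set
  Matches N M f g φ ψ =
    ∀ i → InRange N i → ¬ f i ≡ 0 → InRange M (φ i) × ψ (φ i) ≡ i × g (φ i) ≡ f i

  private
    vanishes-off-match : ∀ {N M f g φ ψ i j} → Matches N M f g φ ψ → InRange N i →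
                         j ≡ φ i → ¬ i ≡ ψ j → f i ≡ 0
    vanishes-off-match {f = f} {i = i} match i∈N refl i≢ψj with f i ≟ 0
    ... | yes fi≡0 = fi≡0
    ... | no fi≢0  = ⊥-elim (i≢ψj (sym (proj₁ (proj₂ (match i i∈N fi≢0)))))

    matched-when : ∀ {N M f g φ ψ} → Matches N M f g φ ψ → Matches M N g f ψ φ →
                   ∀ {i j} → InRange N i → InRange M j → (f i when (j ≟ φ i)) ≡ (g j when (i ≟ ψ j))
    matched-when {f = f} {g = g} {φ = φ} {ψ = ψ} H₁ H₂ {i} {j} i∈N j∈M with j ≟ φ i | i ≟ ψ j
    ... | no _      | no _      = refl
    ... | yes j≡φi  | no i≢ψj   = vanishes-off-match {g = g} H₁ i∈N j≡φi i≢ψj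
    ... | no j≢φi   | yes i≡ψj  = sym (vanishes-off-match {g = f} H₂ j∈M i≡ψj j≢φi)
    ... | yes j≡φi  | yes i≡ψj  with f i ≟ 0 | g j ≟ 0
    ...   | yes fi≡0 | yes gj≡0 = trans fi≡0 (sym gj≡0)
    ...   | no fi≢0  | _        = trans (sym (proj₂ (proj₂ (H₁ i i∈N fi≢0)))) (cong g (sym j≡φi))
    ...   | yes _    | no gj≢0  = trans (cong f i≡ψj) (proj₂ (proj₂ (H₂ j j∈M gj≢0)))

  -- Both sides are the double sum of f i when j ≡ φ i, rewritten by matched-when as that of g j when i ≡ ψ j.
  ∑-reindex : ∀ N M {f g} (φ ψ : ℕ → ℕ) → Matches N M f g φ ψ → Matches M N g f ψ φ → ∑ N f ≡ ∑ M g
  ∑-reindex N M {f} {g} φ ψ H₁ H₂ = begin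
    ∑ N f
      ≡⟨ ∑-cong N (λ i i∈N → sym (∑-spike M (f i) (φ i) (proj₁ ∘ H₁ i i∈N))) ⟩
    ∑ N (λ i → ∑ M (λ j → f i when (j ≟ φ i)))
      ≡⟨ ∑-comm N M _ ⟩
    ∑ M (λ j → ∑ N (λ i → f i when (j ≟ φ i)))
      ≡⟨ ∑-cong M (λ j j∈M → ∑-cong N (λ i i∈N → matched-when H₁ H₂ i∈N j∈M)) ⟩
    ∑ M (λ j → ∑ N (λ i → g j when (i ≟ ψ j)))
      ≡⟨ ∑-cong M (λ j j∈M → ∑-spike N (g j) (ψ j) (proj₁ ∘ H₂ j j∈M)) ⟩
    ∑ M g
      ∎
    where open ≡-Reasoning

  ∑-truncate : ∀ {N M} f → M ≤ N → (∀ i → InRange N i → ¬ f i ≡ 0 → i ≤ M) → ∑ N f ≡ ∑ M f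
  ∑-truncate {N} {M} f M≤N bounded = ∑-reindex N M id id
    (λ i i∈N@(1≤i , _) fi≢0 → (1≤i , bounded i i∈N fi≢0) , refl , refl)
    (λ j (1≤j , j≤M) _ → (1≤j , ≤-trans j≤M M≤N) , refl , refl)

  sum-map-one-to : ∀ N f → sum (map f (one-to N)) ≡ ∑ N f
  sum-map-one-to zero    f = refl
  sum-map-one-to (suc N) f = begin
    sum (map f (map suc (upTo (suc N))))              ≡⟨ cong (λ xs → sum (map f (map suc xs))) (upTo-∷ʳ N) ⟨
    sum (map f (map suc (upTo N ++ [ N ])))           ≡⟨ cong (sum ∘ map f) (map-++ suc (upTo N) [ N ]) ⟩
    sum (map f (one-to N ++ [ suc N ]))               ≡⟨ cong sum (map-++ f (one-to N) [ suc N ]) ⟩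
    sum (map f (one-to N) ++ [ f (suc N) ])           ≡⟨ sum-++ (map f (one-to N)) [ f (suc N) ] ⟩
    sum (map f (one-to N)) + (f (suc N) + 0)          ≡⟨ cong₂ _+_ (sum-map-one-to N f) (+-identityʳ _) ⟩
    ∑ (suc N) f                                       ∎
    where open ≡-Reasoning

  sum-map-filter : ∀ {A : Set} {p} {P : Pred A p} (P? : Decidable P) (f : A → ℕ) xs →
                   sum (map f (filter P? xs)) ≡ sum (map (λ x → f x when P? x) xs)
  sum-map-filter P? f []       = refl
  sum-map-filter P? f (x ∷ xs) with P? x
  ... | yes _ = cong (f x +_) (sum-map-filter P? f xs)
  ... | no _  = sum-map-filter P? f xs

  sum-map-concatMap : ∀ {A B : Set} (f : B → ℕ) (F : A → List B) xs →
                      sum (map f (concatMap F xs)) ≡ sum (map (sum ∘ map f ∘ F) xs)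
  sum-map-concatMap f F []       = refl
  sum-map-concatMap f F (x ∷ xs) = begin
    sum (map f (F x ++ concatMap F xs))               ≡⟨ cong sum (map-++ f (F x) _) ⟩
    sum (map f (F x) ++ map f (concatMap F xs))       ≡⟨ sum-++ (map f (F x)) _ ⟩
    sum (map f (F x)) + sum (map f (concatMap F xs))  ≡⟨ cong (sum (map f (F x)) +_) (sum-map-concatMap f F xs) ⟩
    sum (map (sum ∘ map f ∘ F) (x ∷ xs))              ∎
    where open ≡-Reasoning

  length≡sum-map-1 : ∀ {A : Set} (xs : List A) → length xs ≡ sum (map (λ _ → 1) xs)
  length≡sum-map-1 []       = refl
  length≡sum-map-1 (x ∷ xs) = cong suc (length≡sum-map-1 xs)

module Parity where

  open import Data.Nat using (suc; _+_; _*_; _/_; _%_; s≤s)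
  open import Data.Nat.Properties using (*-comm; *-zeroʳ; *-cancelˡ-≡; *-assoc)
  open import Data.Nat.DivMod using (m≡m%n+[m/n]*n; [m+kn]%n≡m%n; m*n%n≡0; m%n<n; %-distribˡ-*)
  open import Data.Nat.Divisibility using (_∣_; divides)
  open import Data.Product using (∃; _,_)
  open import Data.Sum using (_⊎_; inj₁; inj₂)
  open import Relation.Nullary using (¬_; contradiction)
  open import Relation.Binary.PropositionalEquality
  open import Defs using (Odd; Even)

  even⊎odd : ∀ k → Even k ⊎ Odd k
  even⊎odd k with k % 2 | m%n<n k 2
  ... | 0 | _ = inj₁ refl
  ... | 1 | _ = inj₂ refl
  ... | suc (suc _) | s≤s (s≤s ())

  ¬even⇒odd : ∀ {k} → ¬ Even k → Odd k
  ¬even⇒odd {k} ¬even with even⊎odd k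
  ... | inj₁ even = contradiction even ¬even
  ... | inj₂ odd  = odd

  even⇒¬odd : ∀ {k} → Even k → ¬ Odd k
  even⇒¬odd even odd with trans (sym even) odd
  ... | ()

  2*-even : ∀ j → Even (2 * j)
  2*-even j = trans (cong (_% 2) (*-comm 2 j)) (m*n%n≡0 j 2)

  1+2*-odd : ∀ j → Odd (suc (2 * j))
  1+2*-odd j = trans (cong (λ x → suc x % 2) (*-comm 2 j)) ([m+kn]%n≡m%n 1 j 2)

  even⇒≡2* : ∀ {k} → Even k → ∃ λ q → k ≡ 2 * q
  even⇒≡2* {k} even =
    k / 2 , trans (m≡m%n+[m/n]*n k 2) (trans (cong (_+ (k / 2) * 2) even) (*-comm (k / 2) 2))

  odd⇒≡1+2* : ∀ {k} → Odd k → ∃ λ j → k ≡ suc (2 * j)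
  odd⇒≡1+2* {k} odd =
    k / 2 , trans (m≡m%n+[m/n]*n k 2) (trans (cong (_+ (k / 2) * 2) odd) (cong suc (*-comm (k / 2) 2)))

  even-*ˡ : ∀ q {d} → Even d → Even (q * d)
  even-*ˡ q {d} even =
    trans (%-distribˡ-* q d 2) (trans (cong (λ r → (q % 2 * r) % 2) even) (cong (_% 2) (*-zeroʳ (q % 2))))

  odd-* : ∀ {x y} → Odd x → Odd y → Odd (x * y)
  odd-* {x} {y} ox oy = trans (%-distribˡ-* x y 2) (cong₂ (λ a b → (a * b) % 2) ox oy)

  odd-∣ : ∀ {d x} → d ∣ x → Odd x → Odd d
  odd-∣ {d} (divides q refl) ox with even⊎odd d
  ... | inj₁ ed = contradiction ox (even⇒¬odd {q * d} (even-*ˡ q ed))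
  ... | inj₂ od = od

  odd∣2*⇒∣ : ∀ {t n} → Odd t → t ∣ 2 * n → t ∣ n
  odd∣2*⇒∣ {t} {n} ot (divides q 2n≡qt) with even⊎odd q
  ... | inj₂ oq = contradiction (subst Odd (sym 2n≡qt) (odd-* {q} {t} oq ot)) (even⇒¬odd {2 * n} (2*-even n))
  ... | inj₁ eq with even⇒≡2* {q} eq
  ...   | r , refl = divides r (*-cancelˡ-≡ n (r * t) 2 (trans 2n≡qt (*-assoc 2 r t)))

module ConsecutiveSums where

  open import Data.Nat using (zero; suc; _+_; _*_; _≤_; z≤n; s≤s)
  open import Data.Nat.Properties using (*-cancelˡ-≡; *-distribˡ-+; +-cancelʳ-≡; m≤m+n; m≤n+m; ≤-trans)
  open import Data.Nat.Tactic.RingSolver using (solve-∀)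
  open import Relation.Binary.PropositionalEquality
  open import Defs using (consecSum)

  2*consecSum+ℓ : ∀ c ℓ → 2 * consecSum c ℓ + ℓ ≡ ℓ * (2 * c + ℓ)
  2*consecSum+ℓ c zero    = refl
  2*consecSum+ℓ c (suc ℓ) = begin
    2 * (c + consecSum (suc c) ℓ) + suc ℓ     ≡⟨ regroup c ℓ (consecSum (suc c) ℓ) ⟩
    (2 * consecSum (suc c) ℓ + ℓ) + suc (2 * c) ≡⟨ cong (_+ suc (2 * c)) (2*consecSum+ℓ (suc c) ℓ) ⟩
    ℓ * (2 * suc c + ℓ) + suc (2 * c)          ≡⟨ expand c ℓ ⟩
    suc ℓ * (2 * c + suc ℓ)                    ∎
    where
    open ≡-Reasoning
    regroup : ∀ c ℓ x → 2 * (c + x) + suc ℓ ≡ (2 * x + ℓ) + suc (2 * c)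
    regroup = solve-∀
    expand : ∀ c ℓ → ℓ * (2 * suc c + ℓ) + suc (2 * c) ≡ suc ℓ * (2 * c + suc ℓ)
    expand = solve-∀

  consecSum-odd : ∀ c j → consecSum c (suc (2 * j)) ≡ suc (2 * j) * (c + j)
  consecSum-odd c j = *-cancelˡ-≡ _ _ 2 (+-cancelʳ-≡ (suc (2 * j)) _ _
    (trans (2*consecSum+ℓ c (suc (2 * j))) (factor c j)))
    where
    factor : ∀ c j → suc (2 * j) * (2 * c + suc (2 * j)) ≡ 2 * (suc (2 * j) * (c + j)) + suc (2 * j)
    factor = solve-∀

  consecSum-even : ∀ c q → consecSum (suc c) (2 * q) ≡ q * suc (2 * (c + q))
  consecSum-even c q = +-cancelʳ-≡ q _ _ (*-cancelˡ-≡ _ _ 2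
    (trans (*-distribˡ-+ 2 (consecSum (suc c) (2 * q)) q) (trans (2*consecSum+ℓ (suc c) (2 * q)) (factor c q))))
    where
    factor : ∀ c q → 2 * q * (2 * suc c + 2 * q) ≡ 2 * (q * suc (2 * (c + q)) + q)
    factor = solve-∀

  consecSum-injective : ∀ {ℓ c c′} → 1 ≤ ℓ → consecSum c ℓ ≡ consecSum c′ ℓ → c ≡ c′
  consecSum-injective {suc ℓ} {c} {c′} _ eq =
    *-cancelˡ-≡ c c′ 2 (+-cancelʳ-≡ (suc ℓ) _ _ (*-cancelˡ-≡ _ _ (suc ℓ) (begin
      suc ℓ * (2 * c + suc ℓ)           ≡⟨ 2*consecSum+ℓ c (suc ℓ) ⟨
      2 * consecSum c (suc ℓ) + suc ℓ   ≡⟨ cong (λ x → 2 * x + suc ℓ) eq ⟩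
      2 * consecSum c′ (suc ℓ) + suc ℓ  ≡⟨ 2*consecSum+ℓ c′ (suc ℓ) ⟩
      suc ℓ * (2 * c′ + suc ℓ)          ∎)))
    where open ≡-Reasoning

  smallest≤consecSum : ∀ c ℓ → c ≤ consecSum c (suc ℓ)
  smallest≤consecSum c ℓ = m≤m+n c _

  length≤consecSum : ∀ c ℓ → ℓ ≤ consecSum (suc c) ℓ
  length≤consecSum c zero    = z≤n
  length≤consecSum c (suc ℓ) = s≤s (≤-trans (length≤consecSum (suc c) ℓ) (m≤n+m _ c))

module Maximum where

  open import Data.Nat using (_≤_; _⊔_)
  open import Data.Nat.Properties using (≤-trans; m≤m⊔n; m≤n⊔m; ⊔-sel)
  open import Data.List using (List; []; _∷_; foldr)
  open import Data.List.Membership.Propositional using (_∈_)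
  open import Data.List.Relation.Unary.Any using (here; there)
  open import Data.Sum using (_⊎_; inj₁; inj₂)
  open import Relation.Binary.PropositionalEquality

  ∈⇒≤foldr-⊔ : ∀ {x xs} → x ∈ xs → x ≤ foldr _⊔_ 0 xs
  ∈⇒≤foldr-⊔ {xs = y ∷ xs} (here refl) = m≤m⊔n y _
  ∈⇒≤foldr-⊔ {xs = y ∷ xs} (there x∈xs) = ≤-trans (∈⇒≤foldr-⊔ x∈xs) (m≤n⊔m y _)

  foldr-⊔-sel : ∀ xs → foldr _⊔_ 0 xs ≡ 0 ⊎ foldr _⊔_ 0 xs ∈ xs
  foldr-⊔-sel []       = inj₁ refl
  foldr-⊔-sel (x ∷ xs) with ⊔-sel x (foldr _⊔_ 0 xs)
  ... | inj₁ ≡x = inj₂ (here ≡x)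
  ... | inj₂ ≡max with foldr-⊔-sel xs
  ...   | inj₁ max≡0   = inj₁ (trans ≡max max≡0)
  ...   | inj₂ max∈xs  = inj₂ (there (subst (_∈ xs) (sym ≡max) max∈xs))

module LargestOddDivisor (n : ℕ) .{{_ : NonZero n}} where

  open import Data.Nat using (suc; _≤_; z≤n; s≤s; >-nonZero; ≢-nonZero⁻¹)
  open import Data.Nat.Properties using (≤-antisym)
  open import Data.Nat.Divisibility using (_∣_; _∣?_; ∣-trans; ∣⇒≤; 1∣_; m∣m*n; n∣m*n; 0∣⇒≡0)
  open import Data.Nat.LCM using (lcm; m∣lcm[m,n]; n∣lcm[m,n]; lcm-least)
  open import Data.List using (filter)
  open import Data.List.Membership.Propositional using (_∈_)
  open import Data.List.Membership.Propositional.Properties using (∈-filter⁺; ∈-filter⁻; ∈-map⁺; ∈-upTo⁺)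
  open import Data.Product using (_×_; _,_; proj₁; proj₂)
  open import Data.Sum using (inj₁; inj₂)
  open import Relation.Nullary using (contradiction)
  open import Relation.Binary.PropositionalEquality
  open import Defs using (Odd; odd?; one-to; divisors; largestOddDivisor)

  open Parity
  open Maximum

  private
    m : ℕ
    m = largestOddDivisor n

  1≤divisor : ∀ {d} → d ∣ n → 1 ≤ d
  1≤divisor {0}     0∣n = contradiction (0∣⇒≡0 0∣n) (≢-nonZero⁻¹ n)
  1≤divisor {suc _} _   = s≤s z≤n

  private
    odd-divisor∈ : ∀ {d} → Odd d → d ∣ n → d ∈ filter odd? (divisors n)
    odd-divisor∈ {0}     ()  _
    odd-divisor∈ {suc d} odd d∣n =
      ∈-filter⁺ odd? (∈-filter⁺ (_∣? n) (∈-map⁺ suc (∈-upTo⁺ (∣⇒≤ d∣n))) d∣n) odd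

    odd×∣⇒≤largestOddDivisor : ∀ {d} → Odd d → d ∣ n → d ≤ m
    odd×∣⇒≤largestOddDivisor odd d∣n = ∈⇒≤foldr-⊔ (odd-divisor∈ odd d∣n)

  largestOddDivisor-odd×∣ : Odd m × m ∣ n
  largestOddDivisor-odd×∣ with foldr-⊔-sel (filter odd? (divisors n))
  ... | inj₁ m≡0 = contradiction (subst (1 ≤_) m≡0 (odd×∣⇒≤largestOddDivisor {1} refl (1∣ n))) λ ()
  ... | inj₂ m∈  with ∈-filter⁻ odd? {xs = divisors n} m∈
  ...   | m∈divisors , odd = odd , proj₂ (∈-filter⁻ (_∣? n) {xs = one-to n} m∈divisors)

  largestOddDivisor-odd : Odd m
  largestOddDivisor-odd = proj₁ largestOddDivisor-odd×∣

  largestOddDivisor∣n : m ∣ n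
  largestOddDivisor∣n = proj₂ largestOddDivisor-odd×∣

  1≤largestOddDivisor : 1 ≤ m
  1≤largestOddDivisor = 1≤divisor largestOddDivisor∣n

  largestOddDivisor≤n : m ≤ n
  largestOddDivisor≤n = ∣⇒≤ largestOddDivisor∣n

  ∣largestOddDivisor⇒odd×∣ : ∀ {t} → t ∣ m → Odd t × t ∣ n
  ∣largestOddDivisor⇒odd×∣ t∣m = odd-∣ t∣m largestOddDivisor-odd , ∣-trans t∣m largestOddDivisor∣n

  -- lcm t m is an odd divisor of n that m divides, so maximality of m forces lcm t m = m.
  odd×∣⇒∣largestOddDivisor : ∀ {t} → Odd t → t ∣ n → t ∣ m
  odd×∣⇒∣largestOddDivisor {t} odd t∣n = subst (t ∣_) lcm≡m (m∣lcm[m,n] t m)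
    where
    lcm∣n : lcm t m ∣ n
    lcm∣n = lcm-least t∣n largestOddDivisor∣n
    lcm-odd : Odd (lcm t m)
    lcm-odd = odd-∣ (lcm-least {t} {m} (m∣m*n m) (n∣m*n t)) (odd-* {t} {m} odd largestOddDivisor-odd)
    lcm≡m : lcm t m ≡ m
    lcm≡m = ≤-antisym (odd×∣⇒≤largestOddDivisor lcm-odd lcm∣n)
                      (∣⇒≤ {{>-nonZero (1≤divisor lcm∣n)}} (n∣lcm[m,n] t m))

module TotalDivision where

  open import Data.Nat using (zero; suc; _*_; _/_; _≤_)
  open import Data.Nat.DivMod using (m*n/n≡m)
  open import Relation.Binary.PropositionalEquality

  infixl 7 _÷_

  -- total division, with the junk value a ÷ 0 = 0
  _÷_ : ℕ → ℕ → ℕ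
  a ÷ zero  = 0
  a ÷ suc b = a / suc b

  ÷-exact : ∀ {a b c} → 1 ≤ b → a ≡ c * b → a ÷ b ≡ c
  ÷-exact {b = suc b} {c} _ refl = m*n/n≡m c (suc b)

module Cofactors (n : ℕ) .{{_ : NonZero n}} where

  open import Data.Nat using (suc; _*_; _≤_)
  open import Data.Nat.Properties using (*-assoc)
  open import Data.Nat.Divisibility using (_∣_; divides; _∣?_)
  open import Data.Nat.Tactic.RingSolver using (solve-∀)
  open import Data.Product using (∃₂; _×_; _,_)
  open import Relation.Binary.PropositionalEquality
  open import Defs

  open FiniteSums
  open Parity
  open LargestOddDivisor n
  open TotalDivision

  m : ℕ
  m = largestOddDivisor n

  cofactor : ℕ → ℕ
  cofactor t = 2 * n ÷ t

  odd-divisor-view : ∀ {t} → t ∣ m → ∃₂ λ j q → t ≡ suc (2 * j) × n ≡ q * t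
  odd-divisor-view {t} t∣m with ∣largestOddDivisor⇒odd×∣ t∣m
  ... | odd , divides q n≡qt with odd⇒≡1+2* {t} odd
  ...   | j , t≡1+2j = j , q , t≡1+2j , n≡qt

  cofactor-divisor : ∀ q {t} → 1 ≤ t → n ≡ q * t → cofactor t ≡ 2 * q
  cofactor-divisor q {t} 1≤t n≡qt = ÷-exact 1≤t (trans (cong (2 *_) n≡qt) (sym (*-assoc 2 q t)))

  cofactor-double : ∀ q {t} → 1 ≤ 2 * q → n ≡ q * t → cofactor (2 * q) ≡ t
  cofactor-double q {t} 1≤2q n≡qt = ÷-exact 1≤2q (trans (cong (2 *_) n≡qt) (double q t))
    where
    double : ∀ q t → 2 * (q * t) ≡ t * (2 * q)
    double = solve-∀

  oddDivisorTerm cofactorTerm : ℕ → ℕ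
  oddDivisorTerm t = t when (t ∣? m)
  cofactorTerm t   = cofactor t when (t ∣? m)

module DivisorSums (n : ℕ) .{{_ : NonZero n}} where

  open import Data.Nat using (_+_; _*_; _≤_; z≤n; s≤s; >-nonZero)
  open import Data.Nat.Properties
    using (*-assoc; *-cancelˡ-≡; *-comm; *-monoʳ-≤; +-cancelˡ-≡; +-identityʳ; m≤m+n; ≤-trans)
  open import Data.Nat.Divisibility using (_∣_; divides; _∣?_; ∣⇒≤; ∣-trans; n∣m*n; *-monoʳ-∣)
  open import Data.Nat.Tactic.RingSolver using (solve-∀)
  open import Data.Product using (_,_; proj₁; proj₂)
  open import Relation.Nullary using (Dec; yes; no; ¬_; ¬?; contradiction)
  open import Data.List using (map; filter; length)
  open import Data.List.Properties using (map-id)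
  open import Data.Nat.ListAction using (sum)
  open import Data.Sum using (inj₁; inj₂)
  open import Function using (id; _∘_)
  open import Relation.Binary.PropositionalEquality
  open import Defs

  open FiniteSums
  open Parity
  open LargestOddDivisor n
  open TotalDivision
  open Cofactors n

  divisorTerm divisor2nTerm divisor2n∤nTerm evenDivisor2nTerm : ℕ → ℕ
  divisorTerm d       = d when (d ∣? n)
  divisor2nTerm e     = e when (e ∣? 2 * n)
  divisor2n∤nTerm e   = e when ¬? (e ∣? n) when (e ∣? 2 * n)
  evenDivisor2nTerm e = e when even? e when (e ∣? 2 * n)

  ∣⇒∣2n : ∀ {e} → e ∣ n → e ∣ 2 * n
  ∣⇒∣2n e∣n = ∣-trans e∣n (n∣m*n 2)

  divisor2nTerm-by-n : ∀ e → divisor2nTerm e ≡ divisorTerm e + divisor2n∤nTerm e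
  divisor2nTerm-by-n e with e ∣? 2 * n | e ∣? n
  ... | no e∤2n | e∣?n   = sym (trans (+-identityʳ _) (when-no e∣?n (e∤2n ∘ ∣⇒∣2n)))
  ... | yes _   | yes _  = sym (+-identityʳ e)
  ... | yes _   | no _   = refl

  divisor2nTerm-by-parity : ∀ e → divisor2nTerm e ≡ oddDivisorTerm e + evenDivisor2nTerm e
  divisor2nTerm-by-parity e with e ∣? m | e ∣? 2 * n | even? e
  ... | no _    | no _     | _        = refl
  ... | no _    | yes _    | yes _    = refl
  ... | yes _   | yes _    | no _     = sym (+-identityʳ e)
  ... | yes e∣m | no e∤2n  | _        = contradiction (∣⇒∣2n (proj₂ (∣largestOddDivisor⇒odd×∣ e∣m))) e∤2n
  ... | yes e∣m | yes _    | yes even = contradiction (proj₁ (∣largestOddDivisor⇒odd×∣ e∣m)) (even⇒¬odd {e} even)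
  ... | no e∤m  | yes e∣2n | no ¬even = contradiction (odd×∣⇒∣largestOddDivisor odd (odd∣2*⇒∣ odd e∣2n)) e∤m
    where odd = ¬even⇒odd {e} ¬even

  divisor2n∤n-matches : Matches (2 * n) n divisor2n∤nTerm cofactorTerm cofactor cofactor
  divisor2n∤n-matches e (1≤e , _) term≢0 with e ∣? 2 * n | e ∣? n
  ... | no _ | _     = contradiction refl term≢0
  ... | yes _ | yes _ = contradiction refl term≢0
  ... | yes (divides k 2n≡ke) | no e∤n =
    subst (InRange n) (sym cofactor≡k) (1≤divisor k∣n , ∣⇒≤ k∣n) ,
    trans (cong cofactor cofactor≡k) cofactor-k≡e ,
    trans (cong cofactorTerm cofactor≡k)
          (trans (when-yes (k ∣? m) (odd×∣⇒∣largestOddDivisor k-odd k∣n)) cofactor-k≡e)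
    where
    cofactor≡k : cofactor e ≡ k
    cofactor≡k = ÷-exact 1≤e 2n≡ke
    k-odd : Odd k
    k-odd with even⊎odd k
    ... | inj₂ odd = odd
    ... | inj₁ even with even⇒≡2* {k} even
    ...   | s , refl = contradiction (divides s (*-cancelˡ-≡ n (s * e) 2 (trans 2n≡ke (*-assoc 2 s e)))) e∤n
    k∣n : k ∣ n
    k∣n = odd∣2*⇒∣ k-odd (divides e (trans 2n≡ke (*-comm k e)))
    cofactor-k≡e : cofactor k ≡ e
    cofactor-k≡e = ÷-exact (1≤divisor k∣n) (trans 2n≡ke (*-comm k e))

  cofactorTerm-matches : Matches n (2 * n) cofactorTerm divisor2n∤nTerm cofactor cofactor
  cofactorTerm-matches t (1≤t , _) term≢0 with t ∣? m
  ... | no _    = contradiction refl term≢0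
  ... | yes t∣m with odd-divisor-view t∣m
  ...   | j , q , refl , n≡qt =
    subst (InRange (2 * n)) (sym cofactor≡2q) (1≤2q , *-monoʳ-≤ 2 (∣⇒≤ q∣n)) ,
    trans (cong cofactor cofactor≡2q) (cofactor-double q 1≤2q n≡qt) ,
    trans (cong divisor2n∤nTerm cofactor≡2q) (trans value (sym cofactor≡2q))
    where
    cofactor≡2q : cofactor t ≡ 2 * q
    cofactor≡2q = cofactor-divisor q (s≤s z≤n) n≡qt
    q∣n : q ∣ n
    q∣n = divides t (trans n≡qt (*-comm q t))
    1≤2q : 1 ≤ 2 * q
    1≤2q = ≤-trans (1≤divisor q∣n) (m≤m+n q _)
    2q∤n : ¬ 2 * q ∣ n
    2q∤n (divides k n≡k2q) = even⇒¬odd {t} (subst Even (sym t≡2k) (2*-even k)) (1+2*-odd j)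
      where
      t≡2k : t ≡ 2 * k
      t≡2k = *-cancelˡ-≡ t (2 * k) q {{>-nonZero (1≤divisor q∣n)}}
               (trans (sym n≡qt) (trans n≡k2q (regroup k q)))
        where
        regroup : ∀ k q → k * (2 * q) ≡ q * (2 * k)
        regroup = solve-∀
    value : divisor2n∤nTerm (2 * q) ≡ 2 * q
    value = trans (when-yes (2 * q ∣? 2 * n) (divides t (trans (cong (2 *_) n≡qt) (regroup q t))))
                  (when-yes (¬? (2 * q ∣? n)) 2q∤n)
      where
      regroup : ∀ q t → 2 * (q * t) ≡ t * (2 * q)
      regroup = solve-∀

  evenDivisor2n-matches : Matches (2 * n) n evenDivisor2nTerm (λ d → 2 * divisorTerm d) (_÷ 2) (2 *_)
  evenDivisor2n-matches e _ term≢0 with e ∣? 2 * n | even? e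
  ... | no _  | _      = contradiction refl term≢0
  ... | yes _ | no _   = contradiction refl term≢0
  ... | yes (divides k 2n≡ke) | yes even with even⇒≡2* {e} even
  ...   | d , refl =
    subst (InRange n) (sym half) (1≤divisor d∣n , ∣⇒≤ d∣n) ,
    cong (2 *_) half ,
    trans (cong (λ x → 2 * divisorTerm x) half) (cong (2 *_) (when-yes (d ∣? n) d∣n))
    where
    half : 2 * d ÷ 2 ≡ d
    half = ÷-exact (s≤s z≤n) (*-comm 2 d)
    d∣n : d ∣ n
    d∣n = divides k (*-cancelˡ-≡ n (k * d) 2 (trans 2n≡ke (regroup k d)))
      where
      regroup : ∀ k d → k * (2 * d) ≡ 2 * (k * d)
      regroup = solve-∀

  double-matches : Matches n (2 * n) (λ d → 2 * divisorTerm d) evenDivisor2nTerm (2 *_) (_÷ 2)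
  double-matches d (1≤d , d≤n) term≢0 with d ∣? n
  ... | no _    = contradiction refl term≢0
  ... | yes d∣n =
    (≤-trans 1≤d (m≤m+n d _) , *-monoʳ-≤ 2 d≤n) ,
    ÷-exact (s≤s z≤n) (*-comm 2 d) ,
    trans (when-yes (2 * d ∣? 2 * n) (*-monoʳ-∣ 2 d∣n)) (when-yes (even? (2 * d)) (2*-even d))

  ∑divisor2nTerm-by-n : ∑ (2 * n) divisor2nTerm ≡ ∑ n divisorTerm + ∑ n cofactorTerm
  ∑divisor2nTerm-by-n = begin
    ∑ (2 * n) divisor2nTerm
      ≡⟨ ∑-cong (2 * n) (λ e _ → divisor2nTerm-by-n e) ⟩
    ∑ (2 * n) (λ e → divisorTerm e + divisor2n∤nTerm e)
      ≡⟨ ∑-distrib-+ (2 * n) divisorTerm divisor2n∤nTerm ⟩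
    ∑ (2 * n) divisorTerm + ∑ (2 * n) divisor2n∤nTerm
      ≡⟨ cong₂ _+_ (∑-truncate divisorTerm (m≤m+n n _) divisor≤n)
                   (∑-reindex (2 * n) n cofactor cofactor divisor2n∤n-matches cofactorTerm-matches) ⟩
    ∑ n divisorTerm + ∑ n cofactorTerm
      ∎
    where
    open ≡-Reasoning
    divisor≤n : ∀ d → InRange (2 * n) d → ¬ divisorTerm d ≡ 0 → d ≤ n
    divisor≤n d _ term≢0 with d ∣? n
    ... | yes d∣n = ∣⇒≤ d∣n
    ... | no _    = contradiction refl term≢0

  ∑divisor2nTerm-by-parity : ∑ (2 * n) divisor2nTerm ≡ ∑ n oddDivisorTerm + 2 * ∑ n divisorTerm
  ∑divisor2nTerm-by-parity = begin
    ∑ (2 * n) divisor2nTerm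
      ≡⟨ ∑-cong (2 * n) (λ e _ → divisor2nTerm-by-parity e) ⟩
    ∑ (2 * n) (λ e → oddDivisorTerm e + evenDivisor2nTerm e)
      ≡⟨ ∑-distrib-+ (2 * n) oddDivisorTerm evenDivisor2nTerm ⟩
    ∑ (2 * n) oddDivisorTerm + ∑ (2 * n) evenDivisor2nTerm
      ≡⟨ cong₂ _+_ (∑-truncate oddDivisorTerm (m≤m+n n _) oddDivisor≤n)
                   (∑-reindex (2 * n) n (_÷ 2) (2 *_) evenDivisor2n-matches double-matches) ⟩
    ∑ n oddDivisorTerm + ∑ n (λ d → 2 * divisorTerm d)
      ≡⟨ cong (∑ n oddDivisorTerm +_) (*-distribˡ-∑ 2 n divisorTerm) ⟨
    ∑ n oddDivisorTerm + 2 * ∑ n divisorTerm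
      ∎
    where
    open ≡-Reasoning
    oddDivisor≤n : ∀ t → InRange (2 * n) t → ¬ oddDivisorTerm t ≡ 0 → t ≤ n
    oddDivisor≤n t _ term≢0 with t ∣? m
    ... | yes t∣m = ∣⇒≤ (proj₂ (∣largestOddDivisor⇒odd×∣ t∣m))
    ... | no _    = contradiction refl term≢0

  ∑cofactorTerm≡∑oddDivisorTerm+σ : ∑ n cofactorTerm ≡ ∑ n oddDivisorTerm + ∑ n divisorTerm
  ∑cofactorTerm≡∑oddDivisorTerm+σ = +-cancelˡ-≡ (∑ n divisorTerm) _ _
    (trans (sym ∑divisor2nTerm-by-n) (trans ∑divisor2nTerm-by-parity (regroup (∑ n oddDivisorTerm) (∑ n divisorTerm))))
    where
    regroup : ∀ a b → a + 2 * b ≡ b + (a + b)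
    regroup = solve-∀

  σ≡∑divisorTerm : σ n ≡ ∑ n divisorTerm
  σ≡∑divisorTerm = begin
    sum (filter (_∣? n) (one-to n))           ≡⟨ cong sum (map-id (filter (_∣? n) (one-to n))) ⟨
    sum (map id (filter (_∣? n) (one-to n)))  ≡⟨ sum-map-filter (_∣? n) id (one-to n) ⟩
    sum (map divisorTerm (one-to n))          ≡⟨ sum-map-one-to n divisorTerm ⟩
    ∑ n divisorTerm                           ∎
    where open ≡-Reasoning

  length-filter-divisors : ∀ {p} {P : ℕ → Set p} (P? : ∀ t → Dec (P t)) →
    length (filter P? (divisors m)) ≡ ∑ n (λ t → 1 when P? t when (t ∣? m))
  length-filter-divisors P? = begin
    length (filter P? (divisors m))                              ≡⟨ length≡sum-map-1 (filter P? (divisors m)) ⟩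
    sum (map (λ _ → 1) (filter P? (divisors m)))                 ≡⟨ sum-map-filter P? _ (divisors m) ⟩
    sum (map (λ t → 1 when P? t) (filter (_∣? m) (one-to m)))    ≡⟨ sum-map-filter (_∣? m) _ (one-to m) ⟩
    sum (map term (one-to m))                                    ≡⟨ sum-map-one-to m term ⟩
    ∑ m term                                                     ≡⟨ ∑-truncate term largestOddDivisor≤n term-support ⟨
    ∑ n term                                                     ∎
    where
    open ≡-Reasoning
    term : ℕ → ℕ
    term t = 1 when P? t when (t ∣? m)
    term-support : ∀ t → InRange n t → ¬ term t ≡ 0 → t ≤ m
    term-support t _ term≢0 with t ∣? m
    ... | yes t∣m = ∣⇒≤ {{>-nonZero 1≤largestOddDivisor}} t∣m
    ... | no _    = contradiction refl term≢0

module SmallestPartSums (n : ℕ) .{{_ : NonZero n}} where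

  open import Data.Nat using (zero; suc; _+_; _*_; _≤_; _<_; _<?_; z≤n; s≤s; ≢-nonZero⁻¹)
  open import Data.Nat.Properties
    using (_≟_; *-assoc; *-cancelʳ-<; *-cancelˡ-≡; *-cancelˡ-≤; *-comm; *-distribˡ-+; *-monoˡ-<; *-suc;
           +-cancelʳ-≡; +-comm; +-identityʳ; <-cmp; <⇒≯; <⇒≱; m≤n+m; m≤n⇒∃[o]m+o≡n; ≤-pred)
  open import Relation.Binary using (tri<; tri≈; tri>)
  open import Data.Nat.Divisibility using (_∣_; divides; _∣?_; ∣⇒≤)
  open import Data.Nat.Tactic.RingSolver using (solve-∀)
  open import Data.Product using (∃; _×_; _,_; proj₁; proj₂)
  open import Relation.Nullary using (Dec; yes; no; ¬_; contradiction)
  open import Data.List using (List; map; filter; concatMap)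
  open import Data.List.Properties using (map-cong; map-∘)
  open import Data.Nat.ListAction using (sum)
  open import Function using (_∘_)
  open import Relation.Binary.PropositionalEquality
  open import Defs

  open FiniteSums
  open Parity
  open ConsecutiveSums
  open LargestOddDivisor n
  open Cofactors n
  open DivisorSums n

  -- 0 if n has no partition into ℓ consecutive parts; there is at most one.
  smallestPart : ℕ → ℕ
  smallestPart ℓ = ∑ n (λ c → c when (consecSum c ℓ ≟ n))

  partition-bounds : ∀ {c ℓ} → 1 ≤ c → consecSum c ℓ ≡ n → InRange n c × InRange n ℓ
  partition-bounds {ℓ = zero}          _   0≡n = contradiction (sym 0≡n) (≢-nonZero⁻¹ n)
  partition-bounds {suc c} {suc ℓ} 1≤c sum≡n =
    (1≤c , subst (suc c ≤_) sum≡n (smallest≤consecSum (suc c) ℓ)) ,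
    (s≤s z≤n , subst (suc ℓ ≤_) sum≡n (length≤consecSum c (suc ℓ)))

  smallestPart-≡ : ∀ {c ℓ} → 1 ≤ c → consecSum c ℓ ≡ n → smallestPart ℓ ≡ c
  smallestPart-≡ {c} {ℓ} 1≤c sum≡n = trans (∑-cong n only-c) (∑-spike n c c (λ _ → c∈n))
    where
    c∈n : InRange n c
    c∈n = proj₁ (partition-bounds {ℓ = ℓ} 1≤c sum≡n)
    1≤ℓ : 1 ≤ ℓ
    1≤ℓ = proj₁ (proj₂ (partition-bounds {ℓ = ℓ} 1≤c sum≡n))
    only-c : ∀ c′ → InRange n c′ → (c′ when (consecSum c′ ℓ ≟ n)) ≡ (c when (c′ ≟ c))
    only-c c′ _ with consecSum c′ ℓ ≟ n | c′ ≟ c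
    ... | yes sum′≡n | yes c′≡c = c′≡c
    ... | no _       | no _     = refl
    ... | no sum′≢n  | yes refl = contradiction sum≡n sum′≢n
    ... | yes sum′≡n | no c′≢c  = contradiction (consecSum-injective 1≤ℓ (trans sum′≡n (sym sum≡n))) c′≢c

  smallestPart-≡0 : ∀ {ℓ} → (∀ c → 1 ≤ c → ¬ consecSum c ℓ ≡ n) → smallestPart ℓ ≡ 0
  smallestPart-≡0 {ℓ} no-partition =
    ∑-vanishes n (λ c (1≤c , _) → when-no (consecSum c ℓ ≟ n) (no-partition c 1≤c))

  smallestPart≢0⇒partition : ∀ {ℓ} → ¬ smallestPart ℓ ≡ 0 → ∃ λ c → 1 ≤ c × consecSum c ℓ ≡ n
  smallestPart≢0⇒partition {ℓ} ≢0 with ∑≢0⇒∃ n _ ≢0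
  ... | c , (1≤c , _) , term≢0 with consecSum c ℓ ≟ n
  ...   | yes sum≡n = c , 1≤c , sum≡n
  ...   | no _      = contradiction refl term≢0

  smallestPart-odd-length : ∀ j r → n ≡ (suc j + r) * suc (2 * j) → smallestPart (suc (2 * j)) ≡ suc r
  smallestPart-odd-length j r n≡ = smallestPart-≡ {ℓ = suc (2 * j)} (s≤s z≤n)
    (trans (consecSum-odd (suc r) j) (trans (reorder j r) (sym n≡)))
    where
    reorder : ∀ j r → suc (2 * j) * (suc r + j) ≡ (suc j + r) * suc (2 * j)
    reorder = solve-∀

  smallestPart-even-length : ∀ q r → n ≡ q * suc (2 * (q + r)) → smallestPart (2 * q) ≡ suc r
  smallestPart-even-length q r n≡ = smallestPart-≡ {ℓ = 2 * q} (s≤s z≤n)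
    (trans (consecSum-even r q) (trans (cong (λ x → q * suc (2 * x)) (+-comm r q)) (sym n≡)))

  smallestPart-odd-length-≡0 : ∀ j q → q ≤ j → n ≡ q * suc (2 * j) → smallestPart (suc (2 * j)) ≡ 0
  smallestPart-odd-length-≡0 j q q≤j n≡ = smallestPart-≡0 {suc (2 * j)} no-partition
    where
    c+j≡q : ∀ c → consecSum (suc c) (suc (2 * j)) ≡ n → suc c + j ≡ q
    c+j≡q c sum≡n = *-cancelˡ-≡ _ _ (suc (2 * j))
      (trans (sym (consecSum-odd (suc c) j)) (trans sum≡n (trans n≡ (*-comm q _))))
    no-partition : ∀ c → 1 ≤ c → ¬ consecSum c (suc (2 * j)) ≡ n
    no-partition (suc c) _ sum≡n = <⇒≱ (subst (j <_) (c+j≡q c sum≡n) (s≤s (m≤n+m j c))) q≤j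

  odd-length⇒∣ : ∀ {c ℓ} → Odd ℓ → consecSum c ℓ ≡ n → ℓ ∣ n
  odd-length⇒∣ {c} {ℓ} odd sum≡n with odd⇒≡1+2* {ℓ} odd
  ... | j , refl = divides (c + j) (trans (sym sum≡n) (trans (consecSum-odd c j) (*-comm _ (c + j))))

  square<2n⇒j<q : ∀ {j q} → n ≡ q * suc (2 * j) → suc (2 * j) * suc (2 * j) < 2 * n → j < q
  square<2n⇒j<q {j} {q} n≡qt t²<2n =
    *-cancelˡ-≤ 2 (subst (_≤ 2 * q) (sym (*-suc 2 j)) (*-cancelʳ-< (suc (2 * j)) _ (2 * q) t²<2qt))
    where
    t²<2qt : suc (2 * j) * suc (2 * j) < 2 * q * suc (2 * j)
    t²<2qt = subst (suc (2 * j) * suc (2 * j) <_) (trans (cong (2 *_) n≡qt) (sym (*-assoc 2 q _))) t²<2n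

  2n<square⇒q≤j : ∀ {j q} → n ≡ q * suc (2 * j) → 2 * n < suc (2 * j) * suc (2 * j) → q ≤ j
  2n<square⇒q≤j {j} {q} n≡qt 2n<t² = *-cancelˡ-≤ 2 (≤-pred (*-cancelʳ-< (suc (2 * j)) (2 * q) _ 2qt<t²))
    where
    2qt<t² : 2 * q * suc (2 * j) < suc (2 * j) * suc (2 * j)
    2qt<t² = subst (_< suc (2 * j) * suc (2 * j)) (trans (cong (2 *_) n≡qt) (sym (*-assoc 2 q _))) 2n<t²

  smallestPart-small-divisor : ∀ {t} → t ∣ m → t * t < 2 * n → 2 * smallestPart t + t ≡ cofactor t + 1
  smallestPart-small-divisor t∣m t²<2n with odd-divisor-view t∣m
  ... | j , q , refl , n≡qt with m≤n⇒∃[o]m+o≡n (square<2n⇒j<q {j} {q} n≡qt t²<2n)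
  ...   | r , refl = begin
    2 * smallestPart (suc (2 * j)) + suc (2 * j)  ≡⟨ cong (λ c → 2 * c + suc (2 * j)) (smallestPart-odd-length j r n≡qt) ⟩
    2 * suc r + suc (2 * j)                       ≡⟨ regroup j r ⟩
    2 * (suc j + r) + 1                           ≡⟨ cong (_+ 1) (cofactor-divisor (suc j + r) (s≤s z≤n) n≡qt) ⟨
    cofactor (suc (2 * j)) + 1                    ∎
    where
    open ≡-Reasoning
    regroup : ∀ j r → 2 * suc r + suc (2 * j) ≡ 2 * (suc j + r) + 1
    regroup = solve-∀

  smallestPart-large-divisor : ∀ {t} → t ∣ m → 2 * n < t * t → smallestPart t ≡ 0
  smallestPart-large-divisor t∣m 2n<t² with odd-divisor-view t∣m
  ... | j , q , refl , n≡qt = smallestPart-odd-length-≡0 j q (2n<square⇒q≤j n≡qt 2n<t²) n≡qt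

  smallestPart-cofactor : ∀ {t} → t ∣ m → 2 * n < t * t → 2 * smallestPart (cofactor t) + cofactor t ≡ t + 1
  smallestPart-cofactor t∣m 2n<t² with odd-divisor-view t∣m
  ... | j , q , refl , n≡qt with m≤n⇒∃[o]m+o≡n (2n<square⇒q≤j {j} {q} n≡qt 2n<t²)
  ...   | r , refl = begin
    2 * smallestPart (cofactor t) + cofactor t
      ≡⟨ cong (λ ℓ → 2 * smallestPart ℓ + ℓ) (cofactor-divisor q (s≤s z≤n) n≡qt) ⟩
    2 * smallestPart (2 * q) + 2 * q
      ≡⟨ cong (λ c → 2 * c + 2 * q) (smallestPart-even-length q r n≡qt) ⟩
    2 * suc r + 2 * q
      ≡⟨ regroup q r ⟩
    t + 1
      ∎
    where
    open ≡-Reasoning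
    t = suc (2 * (q + r))
    regroup : ∀ q r → 2 * suc r + 2 * q ≡ suc (2 * (q + r)) + 1
    regroup = solve-∀

  oddTerm evenTerm above below : ℕ → ℕ
  oddTerm t  = smallestPart t when odd? t
  evenTerm t = smallestPart (cofactor t) when (2 * n <? t * t) when (t ∣? m)
  above t    = 1 when (2 * n <? t * t) when (t ∣? m)
  below t    = 1 when (t * t <? 2 * n) when (t ∣? m)

  ∤⇒oddTerm≡0 : ∀ {t} → ¬ t ∣ m → oddTerm t ≡ 0
  ∤⇒oddTerm≡0 {t} t∤m with odd? t
  ... | no _    = refl
  ... | yes odd = smallestPart-≡0 {t} λ c _ sum≡n →
    t∤m (odd×∣⇒∣largestOddDivisor odd (odd-length⇒∣ {c} odd sum≡n))

  -- For an odd divisor t of n, t² < 2n gives the partition into t parts and 2n < t² the one into 2n/t parts.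
  balance : ∀ t → 2 * oddTerm t + above t + oddDivisorTerm t ≡ cofactorTerm t + below t + 2 * evenTerm t
  balance t with t ∣? m
  ... | no t∤m  = cong (λ x → 2 * x + 0 + 0) (∤⇒oddTerm≡0 t∤m)
  ... | yes t∣m with ∣largestOddDivisor⇒odd×∣ t∣m | <-cmp (t * t) (2 * n)
  ...   | odd , _ | tri≈ _ t²≡2n _ =
    contradiction (subst Odd t²≡2n (odd-* {t} {t} odd odd)) (even⇒¬odd {2 * n} (2*-even n))
  ...   | odd , _ | tri< t²<2n _ _ = begin
    2 * oddTerm t + (1 when (2 * n <? t * t)) + t
      ≡⟨ cong₂ (λ x y → 2 * x + y + t) (when-yes (odd? t) odd) (when-no (2 * n <? t * t) (<⇒≯ t²<2n)) ⟩
    2 * smallestPart t + 0 + t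
      ≡⟨ cong (_+ t) (+-identityʳ _) ⟩
    2 * smallestPart t + t
      ≡⟨ smallestPart-small-divisor t∣m t²<2n ⟩
    cofactor t + 1
      ≡⟨ +-identityʳ _ ⟨
    cofactor t + 1 + 2 * 0
      ≡⟨ cong₂ (λ y z → cofactor t + y + 2 * z)
               (when-yes (t * t <? 2 * n) t²<2n) (when-no (2 * n <? t * t) (<⇒≯ t²<2n)) ⟨
    cofactor t + (1 when (t * t <? 2 * n)) + 2 * (smallestPart (cofactor t) when (2 * n <? t * t))
      ∎
    where open ≡-Reasoning
  ...   | odd , _ | tri> _ _ 2n<t² = begin
    2 * oddTerm t + (1 when (2 * n <? t * t)) + t
      ≡⟨ cong₂ (λ x y → 2 * x + y + t)
               (trans (when-yes (odd? t) odd) (smallestPart-large-divisor t∣m 2n<t²)) (when-yes (2 * n <? t * t) 2n<t²) ⟩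
    suc t
      ≡⟨ +-comm 1 t ⟩
    t + 1
      ≡⟨ smallestPart-cofactor t∣m 2n<t² ⟨
    2 * smallestPart (cofactor t) + cofactor t
      ≡⟨ reorder (smallestPart (cofactor t)) (cofactor t) ⟩
    cofactor t + 0 + 2 * smallestPart (cofactor t)
      ≡⟨ cong₂ (λ y z → cofactor t + y + 2 * z)
               (when-no (t * t <? 2 * n) (<⇒≯ 2n<t²)) (when-yes (2 * n <? t * t) 2n<t²) ⟨
    cofactor t + (1 when (t * t <? 2 * n)) + 2 * (smallestPart (cofactor t) when (2 * n <? t * t))
      ∎
    where
    open ≡-Reasoning
    reorder : ∀ s c → 2 * s + c ≡ c + 0 + 2 * s
    reorder = solve-∀

  evenLengthTerm : ℕ → ℕ
  evenLengthTerm ℓ = smallestPart ℓ when even? ℓ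

  evenLength-matches : Matches n n evenLengthTerm evenTerm cofactor cofactor
  evenLength-matches ℓ (1≤ℓ , _) term≢0 with even? ℓ
  ... | no _     = contradiction refl term≢0
  ... | yes even with even⇒≡2* {ℓ} even | smallestPart≢0⇒partition {ℓ} term≢0
  ...   | q , refl | 0 , () , _
  ...   | q , refl | suc c , _ , sum≡n =
    subst (InRange n) (sym cofactor≡t) (1≤t , ∣⇒≤ t∣n) ,
    trans (cong cofactor cofactor≡t) (cofactor-divisor q 1≤t n≡qt) ,
    value
    where
    t = suc (2 * (c + q))
    1≤t : 1 ≤ t
    1≤t = s≤s z≤n
    n≡qt : n ≡ q * t
    n≡qt = trans (sym sum≡n) (consecSum-even c q)
    t∣n : t ∣ n
    t∣n = divides q n≡qt
    cofactor≡t : cofactor (2 * q) ≡ t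
    cofactor≡t = cofactor-double q 1≤ℓ n≡qt
    2q<t : 2 * q < t
    2q<t = s≤s (subst (2 * q ≤_) (sym (*-distribˡ-+ 2 c q)) (m≤n+m (2 * q) (2 * c)))
    2n<t² : 2 * n < t * t
    2n<t² = subst (_< t * t) (sym (trans (cong (2 *_) n≡qt) (sym (*-assoc 2 q t)))) (*-monoˡ-< t 2q<t)
    value : evenTerm (cofactor (2 * q)) ≡ smallestPart (2 * q)
    value = begin
      evenTerm (cofactor (2 * q))
        ≡⟨ cong evenTerm cofactor≡t ⟩
      evenTerm t
        ≡⟨ when-yes (t ∣? m) (odd×∣⇒∣largestOddDivisor (1+2*-odd (c + q)) t∣n) ⟩
      smallestPart (cofactor t) when (2 * n <? t * t)
        ≡⟨ when-yes (2 * n <? t * t) 2n<t² ⟩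
      smallestPart (cofactor t)
        ≡⟨ cong smallestPart (cofactor-divisor q 1≤t n≡qt) ⟩
      smallestPart (2 * q)
        ∎
      where open ≡-Reasoning

  evenTerm-matches : Matches n n evenTerm evenLengthTerm cofactor cofactor
  evenTerm-matches t (1≤t , _) term≢0 with t ∣? m
  ... | no _    = contradiction refl term≢0
  ... | yes t∣m with 2 * n <? t * t
  ...   | no _  = contradiction refl term≢0
  ...   | yes _ with odd-divisor-view t∣m | smallestPart≢0⇒partition {cofactor t} term≢0
  ...     | j , q , refl , n≡qt | c , 1≤c , sum≡n =
    cofactor∈n , trans (cong cofactor cofactor≡2q) (cofactor-double q 1≤2q n≡qt) , value
    where
    cofactor≡2q : cofactor t ≡ 2 * q
    cofactor≡2q = cofactor-divisor q 1≤t n≡qt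
    cofactor∈n : InRange n (cofactor t)
    cofactor∈n = proj₂ (partition-bounds {c} {cofactor t} 1≤c sum≡n)
    1≤2q : 1 ≤ 2 * q
    1≤2q = subst (1 ≤_) cofactor≡2q (proj₁ cofactor∈n)
    value : evenLengthTerm (cofactor t) ≡ smallestPart (cofactor t)
    value = when-yes (even? (cofactor t)) (subst Even (sym cofactor≡2q) (2*-even q))

  sum-smallestParts : ∀ {p} {P : ℕ → Set p} (P? : ∀ ℓ → Dec (P ℓ)) →
    sum (map proj₁ (filter (P? ∘ proj₂) (consecPartitions n))) ≡ ∑ n (λ ℓ → smallestPart ℓ when P? ℓ)
  sum-smallestParts P? = begin
    sum (map proj₁ (filter (P? ∘ proj₂) (filter isPartition? pairs)))
      ≡⟨ sum-map-filter (P? ∘ proj₂) proj₁ (filter isPartition? pairs) ⟩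
    sum (map (λ p → proj₁ p when P? (proj₂ p)) (filter isPartition? pairs))
      ≡⟨ sum-map-filter isPartition? _ pairs ⟩
    sum (map term pairs)
      ≡⟨ sum-map-concatMap term row (one-to n) ⟩
    sum (map (sum ∘ map term ∘ row) (one-to n))
      ≡⟨ cong sum (map-cong (λ c → trans (sym (cong sum (map-∘ (one-to n)))) (sum-map-one-to n _)) (one-to n)) ⟩
    sum (map (λ c → ∑ n (λ ℓ → term (c , ℓ))) (one-to n))
      ≡⟨ sum-map-one-to n _ ⟩
    ∑ n (λ c → ∑ n (λ ℓ → term (c , ℓ)))
      ≡⟨ ∑-comm n n (λ c ℓ → term (c , ℓ)) ⟩
    ∑ n (λ ℓ → ∑ n (λ c → term (c , ℓ)))
      ≡⟨ ∑-cong n (λ ℓ _ → trans (∑-cong n (λ c _ → when-comm (P? ℓ) (consecSum c ℓ ≟ n) c))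
                                  (∑-when n _ (P? ℓ))) ⟩
    ∑ n (λ ℓ → smallestPart ℓ when P? ℓ)
      ∎
    where
    open ≡-Reasoning
    row : ℕ → List (ℕ × ℕ)
    row c = map (c ,_) (one-to n)
    pairs : List (ℕ × ℕ)
    pairs = concatMap row (one-to n)
    isPartition? : (p : ℕ × ℕ) → Dec (consecSum (proj₁ p) (proj₂ p) ≡ n)
    isPartition? (c , ℓ) = consecSum c ℓ ≟ n
    term : ℕ × ℕ → ℕ
    term p = proj₁ p when P? (proj₂ p) when isPartition? p

  sco≡∑oddTerm : sco n ≡ ∑ n oddTerm
  sco≡∑oddTerm = sum-smallestParts odd?

  sce≡∑evenTerm : sce n ≡ ∑ n evenTerm
  sce≡∑evenTerm = trans (sum-smallestParts even?) (∑-reindex n n cofactor cofactor evenLength-matches evenTerm-matches)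

  ∑-left : 2 * sco n + #divAbove m n + ∑ n oddDivisorTerm ≡ ∑ n (λ t → 2 * oddTerm t + above t + oddDivisorTerm t)
  ∑-left = begin
    2 * sco n + #divAbove m n + ∑ n oddDivisorTerm
      ≡⟨ cong₂ (λ s a → 2 * s + a + ∑ n oddDivisorTerm)
               sco≡∑oddTerm (length-filter-divisors (λ t → 2 * n <? t * t)) ⟩
    2 * ∑ n oddTerm + ∑ n above + ∑ n oddDivisorTerm
      ≡⟨ cong (λ s → s + ∑ n above + ∑ n oddDivisorTerm) (*-distribˡ-∑ 2 n oddTerm) ⟩
    ∑ n (λ t → 2 * oddTerm t) + ∑ n above + ∑ n oddDivisorTerm
      ≡⟨ ∑-distrib-+₃ n (λ t → 2 * oddTerm t) above oddDivisorTerm ⟨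
    ∑ n (λ t → 2 * oddTerm t + above t + oddDivisorTerm t)
      ∎
    where open ≡-Reasoning

  ∑-right : ∑ n (λ t → cofactorTerm t + below t + 2 * evenTerm t) ≡ σ n + #divBelow m n + 2 * sce n + ∑ n oddDivisorTerm
  ∑-right = begin
    ∑ n (λ t → cofactorTerm t + below t + 2 * evenTerm t)
      ≡⟨ ∑-distrib-+₃ n cofactorTerm below (λ t → 2 * evenTerm t) ⟩
    ∑ n cofactorTerm + ∑ n below + ∑ n (λ t → 2 * evenTerm t)
      ≡⟨ cong₂ (λ c e → c + ∑ n below + e) ∑cofactorTerm≡∑oddDivisorTerm+σ (sym (*-distribˡ-∑ 2 n evenTerm)) ⟩
    ∑ n oddDivisorTerm + ∑ n divisorTerm + ∑ n below + 2 * ∑ n evenTerm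
      ≡⟨ regroup (∑ n oddDivisorTerm) (∑ n divisorTerm) (∑ n below) (∑ n evenTerm) ⟩
    ∑ n divisorTerm + ∑ n below + 2 * ∑ n evenTerm + ∑ n oddDivisorTerm
      ≡⟨ cong₂ (λ d b → d + b + 2 * ∑ n evenTerm + ∑ n oddDivisorTerm)
               σ≡∑divisorTerm (length-filter-divisors (λ t → t * t <? 2 * n)) ⟨
    σ n + #divBelow m n + 2 * ∑ n evenTerm + ∑ n oddDivisorTerm
      ≡⟨ cong (λ e → σ n + #divBelow m n + 2 * e + ∑ n oddDivisorTerm) sce≡∑evenTerm ⟨
    σ n + #divBelow m n + 2 * sce n + ∑ n oddDivisorTerm
      ∎
    where
    open ≡-Reasoning
    regroup : ∀ o d b e → o + d + b + 2 * e ≡ d + b + 2 * e + o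
    regroup = solve-∀

  2*sco+above≡σ+below+2*sce : 2 * sco n + #divAbove m n ≡ σ n + #divBelow m n + 2 * sce n
  2*sco+above≡σ+below+2*sce =
    +-cancelʳ-≡ (∑ n oddDivisorTerm) _ _ (trans ∑-left (trans (∑-cong n (λ t _ → balance t)) ∑-right))

open import Defs
open import Data.Integer using (+_; _+_; _-_)
open import Data.Rational using (_/_)
open import Relation.Binary.PropositionalEquality using (_≡_; cong; cong₂; module ≡-Reasoning)
import Data.Nat as ℕ
import Data.Integer as ℤ
open import Data.Integer.Properties using (pos-+; pos-*)
open import Data.Integer.Tactic.RingSolver using (solve-∀)
open import Data.Rational.Unnormalised.Base using (mkℚᵘ; *≡*)
open import Data.Rational.Properties using (fromℚᵘ-cong)

difference≡half : ∀ s e σ b a → 2 ℕ.* s ℕ.+ a ≡ σ ℕ.+ b ℕ.+ 2 ℕ.* e →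
                  ((+ s) - (+ e)) / 1 ≡ ((+ σ) + (+ b) - (+ a)) / 2
-- mkℚᵘ p d stands for p / (d + 1).
difference≡half s e σ b a eq = fromℚᵘ-cong {mkℚᵘ (+ s - + e) 0} {mkℚᵘ (+ σ + + b - + a) 1} (*≡* (begin
  (+ s - + e) ℤ.* + 2                              ≡⟨ expand (+ s) (+ e) (+ a) ⟩
  (+ 2 ℤ.* + s + + a) - (+ a + + 2 ℤ.* + e)        ≡⟨ cong (_- (+ a + + 2 ℤ.* + e)) lifted ⟩
  (+ σ + + b + + 2 ℤ.* + e) - (+ a + + 2 ℤ.* + e)  ≡⟨ cancel (+ σ) (+ b) (+ a) (+ e) ⟩
  (+ σ + + b - + a) ℤ.* + 1                        ∎))
  where
  open ≡-Reasoning
  expand : ∀ s e a → (s - e) ℤ.* + 2 ≡ (+ 2 ℤ.* s + a) - (a + + 2 ℤ.* e)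
  expand = solve-∀
  cancel : ∀ σ b a e → (σ + b + + 2 ℤ.* e) - (a + + 2 ℤ.* e) ≡ (σ + b - a) ℤ.* + 1
  cancel = solve-∀
  lifted : + 2 ℤ.* + s + + a ≡ + σ + + b + + 2 ℤ.* + e
  lifted = begin
    + 2 ℤ.* + s + + a            ≡⟨ cong (_+ + a) (pos-* 2 s) ⟨
    + (2 ℕ.* s) + + a            ≡⟨ pos-+ (2 ℕ.* s) a ⟨
    + (2 ℕ.* s ℕ.+ a)            ≡⟨ cong +_ eq ⟩
    + (σ ℕ.+ b ℕ.+ 2 ℕ.* e)      ≡⟨ pos-+ (σ ℕ.+ b) (2 ℕ.* e) ⟩
    + (σ ℕ.+ b) + + (2 ℕ.* e)    ≡⟨ cong₂ _+_ (pos-+ σ b) (pos-* 2 e) ⟩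
    + σ + + b + + 2 ℤ.* + e      ∎

theorem5 : (n : ℕ) → .{{_ : NonZero n}} →
    let m = largestOddDivisor n in
    ((+ sco n) - (+ sce n)) / 1
      ≡ ((+ σ n) + (+ #divBelow m n) - (+ #divAbove m n)) / 2
theorem5 n = difference≡half (sco n) (sce n) (σ n) (#divBelow m n) (#divAbove m n)
               (SmallestPartSums.2*sco+above≡σ+below+2*sce n)
  where m = largestOddDivisor n
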